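{- Let $\mathcal{F}=(W,\preccurlyeq,V_{\mathcal{F}})$ be a finite poset model. For all $w_1,w_2\in W$: if $w_1\equiv_\gamma w_2$ then $w_1\equiv_\eta w_2$.
   Context: $\mathcal{F}$: finite partial order $(W,\preccurlyeq)$ with $V_{\mathcal{F}}:PL\to2^W$. A $\pm$-path of length $\ell\ge2$: $\pi:\{0,\dots,\ell\}\to W$ with consecutive elements comparable under $\preccurlyeq$, $\pi(0)\preccurlyeq\pi(1)$, $\pi(\ell)\preccurlyeq\pi(\ell-1)$. $\mathrm{SLCS}_\gamma$: $\Phi::=p\mid\neg\Phi\mid\Phi_1\wedge\Phi_2\mid\gamma(\Phi_1,\Phi_2)$, with $w\models\gamma(\Phi_1,\Phi_2)$ iff some $\pm$-path $\pi$ of length $\ell$ from $w$ has $\pi(\ell)\models\Phi_2$ and $\pi(i)\models\Phi_1$ for all $0<i<\ell$. $\mathrm{SLCS}_\eta$: $\Phi::=p\mid\neg\Phi\mid\Phi_1\wedge\Phi_2\mid\eta(\Phi_1,\Phi_2)$, with $w\models\eta(\Phi_1,\Phi_2)$ iff some $\pm$-path $\pi$ of length $\ell$ from $w$ has $\pi(\ell)\models\Phi_2$ and $\pi(i)\models\Phi_1$ for all $0\le i<\ell$. Atoms ($w\models p$ iff $w\in V_{\mathcal{F}}(p)$) and Boolean connectives standard. $\equiv_\gamma$, $\equiv_\eta$: satisfying the same formulas of the respective logic. -}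

module Defs where

open import Data.Nat using (ℕ; zero; suc; _≤_; _<_)
open import Data.Fin using (Fin; toℕ; inject₁; fromℕ) renaming (suc to fsuc; zero to fzero)
open import Data.Fin.Subset using (Subset; _∈_)
open import Data.Sum using (_⊎_)
open import Data.Product using (Σ; _×_; ∃)
open import Relation.Nullary using (¬_)
open import Relation.Binary.PropositionalEquality using (_≡_)
open import Function.Bundles using (_⇔_)

record PosetModel (PL : Set) : Set₁ where
  field
    n       : ℕ
    _≼_     : Fin n → Fin n → Set
    ≼-refl  : ∀ w → w ≼ w
    ≼-antisym : ∀ {u w} → u ≼ w → w ≼ u → u ≡ w
    ≼-trans : ∀ {u v w} → u ≼ v → v ≼ w → u ≼ w
    V       : PL → Subset n

module _ {PL : Set} (𝓕 : PosetModel PL) where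
  open PosetModel 𝓕

  W : Set
  W = Fin n

  record ±Path (ℓ : ℕ) : Set where
    field
      len≥2 : 2 ≤ ℓ
      π     : Fin (suc ℓ) → W
      comparable : ∀ (i : Fin ℓ) → (π (inject₁ i) ≼ π (fsuc i)) ⊎ (π (fsuc i) ≼ π (inject₁ i))
      first : (i : Fin ℓ) → toℕ i ≡ 0 → π (inject₁ i) ≼ π (fsuc i)
      last  : (i : Fin ℓ) → suc (toℕ i) ≡ ℓ → π (fsuc i) ≼ π (inject₁ i)

  open ±Path public

  data Formγ : Set where
    atom : PL → Formγ
    neg  : Formγ → Formγ
    conj : Formγ → Formγ → Formγ
    γ    : Formγ → Formγ → Formγ

  data Formη : Set where
    atom : PL → Formη
    neg  : Formη → Formη
    conj : Formη → Formη → Formη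
    η    : Formη → Formη → Formη

  _⊨γ_ : W → Formγ → Set
  w ⊨γ atom p = w ∈ V p
  w ⊨γ neg Φ = ¬ (w ⊨γ Φ)
  w ⊨γ conj Φ₁ Φ₂ = (w ⊨γ Φ₁) × (w ⊨γ Φ₂)
  w ⊨γ γ Φ₁ Φ₂ = Σ ℕ λ ℓ → Σ (±Path ℓ) λ P →
      (π P fzero ≡ w)
    × (π P (fromℕ ℓ) ⊨γ Φ₂)
    × (∀ (i : Fin (suc ℓ)) → 0 < toℕ i → toℕ i < ℓ → π P i ⊨γ Φ₁)

  _⊨η_ : W → Formη → Set
  w ⊨η atom p = w ∈ V p
  w ⊨η neg Φ = ¬ (w ⊨η Φ)
  w ⊨η conj Φ₁ Φ₂ = (w ⊨η Φ₁) × (w ⊨η Φ₂)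
  w ⊨η η Φ₁ Φ₂ = Σ ℕ λ ℓ → Σ (±Path ℓ) λ P →
      (π P fzero ≡ w)
    × (π P (fromℕ ℓ) ⊨η Φ₂)
    × (∀ (i : Fin (suc ℓ)) → toℕ i < ℓ → π P i ⊨η Φ₁)

  _≡γ_ : W → W → Set
  w₁ ≡γ w₂ = ∀ (Φ : Formγ) → (w₁ ⊨γ Φ) ⇔ (w₂ ⊨γ Φ)

  _≡η_ : W → W → Set
  w₁ ≡η w₂ = ∀ (Φ : Formη) → (w₁ ⊨η Φ) ⇔ (w₂ ⊨η Φ)

-- An η-path from w is a γ-path from w whose starting point also satisfies the
-- guard, so η(Φ, Ψ) is expressible as Φ ∧ γ(Φ, Ψ).  Translating every η into
-- this form gives, for each SLCS_η formula, an SLCS_γ formula true at exactly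
-- the same points; hence points that agree on SLCS_γ agree on SLCS_η.
module Submission where

open import Defs
open import Data.Nat using (suc; _<_; s≤s; z≤n)
open import Data.Nat.Properties using (<-≤-trans)
open import Data.Fin using (Fin; toℕ) renaming (suc to fsuc; zero to fzero)
open import Data.Product using (_,_)
open import Data.Product.Function.NonDependent.Propositional using (_×-⇔_)
open import Relation.Binary.PropositionalEquality using (subst; sym)
open import Function.Bundles using (_⇔_; mk⇔; Equivalence)
open import Function.Construct.Composition using (_⇔-∘_)
open import Function.Construct.Identity using (⇔-id)
open import Function.Construct.Symmetry using (⇔-sym)
open import Function.Related.TypeIsomorphisms using (¬-cong-⇔)

module _ {PL : Set} (𝓕 : PosetModel PL) where

  open Equivalence using (to; from)

  η⇔conj-γ : ∀ {Φ Ψ : Formη 𝓕} {Φ′ Ψ′ : Formγ 𝓕} →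
    (∀ w → _⊨η_ 𝓕 w Φ ⇔ _⊨γ_ 𝓕 w Φ′) →
    (∀ w → _⊨η_ 𝓕 w Ψ ⇔ _⊨γ_ 𝓕 w Ψ′) →
    ∀ w → _⊨η_ 𝓕 w (η Φ Ψ) ⇔ _⊨γ_ 𝓕 w (conj Φ′ (γ Φ′ Ψ′))
  η⇔conj-γ {Φ} {Ψ} {Φ′} {Ψ′} Φ⇔Φ′ Ψ⇔Ψ′ w = mk⇔ η→conj-γ conj-γ→η
    where
    η→conj-γ : _⊨η_ 𝓕 w (η Φ Ψ) → _⊨γ_ 𝓕 w (conj Φ′ (γ Φ′ Ψ′))
    η→conj-γ (ℓ , P , starts-at-w , end , guarded) =
      subst (λ v → _⊨γ_ 𝓕 v Φ′) starts-at-w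
        (to (Φ⇔Φ′ _) (guarded fzero (<-≤-trans (s≤s z≤n) (len≥2 P))))
      , (ℓ , P , starts-at-w , to (Ψ⇔Ψ′ _) end
        , λ i _ i<ℓ → to (Φ⇔Φ′ _) (guarded i i<ℓ))

    conj-γ→η : _⊨γ_ 𝓕 w (conj Φ′ (γ Φ′ Ψ′)) → _⊨η_ 𝓕 w (η Φ Ψ)
    conj-γ→η (w⊨Φ′ , ℓ , P , starts-at-w , end , guarded) =
      ℓ , P , starts-at-w , from (Ψ⇔Ψ′ _) end , guarded′
      where
      guarded′ : ∀ (i : Fin (suc ℓ)) → toℕ i < ℓ → _⊨η_ 𝓕 (π P i) Φ
      guarded′ fzero    _    = subst (λ v → _⊨η_ 𝓕 v Φ) (sym starts-at-w)
                                 (from (Φ⇔Φ′ w) w⊨Φ′)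
      guarded′ (fsuc j) j<ℓ = from (Φ⇔Φ′ _) (guarded (fsuc j) (s≤s z≤n) j<ℓ)

  η→γ : Formη 𝓕 → Formγ 𝓕
  η→γ (atom p)   = atom p
  η→γ (neg Φ)    = neg (η→γ Φ)
  η→γ (conj Φ Ψ) = conj (η→γ Φ) (η→γ Ψ)
  η→γ (η Φ Ψ)    = conj (η→γ Φ) (γ (η→γ Φ) (η→γ Ψ))

  ⊨η⇔⊨γ-η→γ : ∀ Φ w → _⊨η_ 𝓕 w Φ ⇔ _⊨γ_ 𝓕 w (η→γ Φ)
  ⊨η⇔⊨γ-η→γ (atom p)   w = ⇔-id _
  ⊨η⇔⊨γ-η→γ (neg Φ)    w = ¬-cong-⇔ (⊨η⇔⊨γ-η→γ Φ w)
  ⊨η⇔⊨γ-η→γ (conj Φ Ψ) w = ⊨η⇔⊨γ-η→γ Φ w ×-⇔ ⊨η⇔⊨γ-η→γ Ψ w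
  ⊨η⇔⊨γ-η→γ (η Φ Ψ)    w = η⇔conj-γ (⊨η⇔⊨γ-η→γ Φ) (⊨η⇔⊨γ-η→γ Ψ) w

proposition3p16 : {PL : Set} (𝓕 : PosetModel PL) (w₁ w₂ : W 𝓕) →
    _≡γ_ 𝓕 w₁ w₂ → _≡η_ 𝓕 w₁ w₂
proposition3p16 𝓕 w₁ w₂ w₁≡γw₂ Φ =
  ⇔-sym (⊨η⇔⊨γ-η→γ 𝓕 Φ w₂) ⇔-∘ (w₁≡γw₂ (η→γ 𝓕 Φ) ⇔-∘ ⊨η⇔⊨γ-η→γ 𝓕 Φ w₁)
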